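{- Let $\alpha\ge 5/3$. Let $G$ be an instance of MAP that is 2-node connected with $|V(G)|\ge12$, and let $C$ be an R8 of $G$. Let $B'_1$ be a 2-ECSS of $G/V(C)$ with $\mathrm{cost}(B'_1)\le\max(\mathrm{opt}(G/V(C)),\ \alpha\,\mathrm{opt}(G/V(C))-2)$. Then there exists $F\subseteq E(C)$ with $\mathrm{cost}(F)\le5$ such that $F\cup E(B'_1)$ is the edge set of a 2-ECSS of $G$ of cost at most $\max(\mathrm{opt}(G),\ \alpha\,\mathrm{opt}(G)-2)$.
   Context: An instance of MAP is a loop-free, 2-edge connected multigraph $G$ with edge costs in $\{0,1\}$ whose cost-$0$ edges form a matching; cost-$1$ edges are unit-edges. A graph is 2-edge connected if it has at least $2$ nodes and is connected after deleting any single edge. It is 2-node connected if it has at least $3$ nodes and is connected after deleting any single node. A 2-ECSS is a 2-edge connected spanning subgraph, and $\mathrm{opt}(\cdot)$ is its minimum cost. $G/S$ identifies the nodes of $S$ into one node and deletes the edges inside $S$; its edges are identified with those of $G$. An attachment of a subgraph $C$ is a node of $C$ with a neighbour in $V(G)-V(C)$. An R8 of $G$ is an induced subgraph $C$ with eight nodes such that $V(C)\ne V(G)$ and all of the following hold. $C$ contains two node-disjoint 4-cycles $C_1,C_2$, each of cost $2$. $C$ has exactly two attachments $a_1,a_2$ with $a_i\in V(C_i)$. For each $i\in\{1,2\}$, both end nodes of the unique unit-edge of $C_i-a_i$ are adjacent to $V(C_{3-i})$.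
   Formalization: The parameter α is taken over the rationals instead of the reals. -}

module Defs where

open import Data.Nat using (ℕ; zero; suc; _+_; _≤_)
open import Data.Fin using (Fin; zero; suc)
open import Data.Fin.Subset using (Subset; _∈_; _∉_; _-_; ⊥; ⊤; ∣_∣; _∪_)
open import Data.Vec using (Vec; []; _∷_)
open import Data.Bool using (Bool; true; false)
open import Data.Product using (Σ; ∃; ∃-syntax; _×_; _,_)
open import Data.Sum using (_⊎_)
open import Relation.Binary.PropositionalEquality using (_≡_; _≢_)
open import Relation.Nullary using (¬_)
open import Data.Integer using (+_)
open import Data.Rational using (ℚ; _/_)
import Data.Rational as Q

-- Finite multigraphs: nodes Fin n, edges Fin m (edges are labelled, so
-- parallel edges are allowed); each edge has two end nodes and a cost.

record Graph (n m : ℕ) : Set where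
  field
    src  : Fin m → Fin n
    tgt  : Fin m → Fin n
    cost : Fin m → ℕ
open Graph public

costOf : ∀ {m} → (Fin m → ℕ) → Subset m → ℕ
costOf {zero}  c []            = 0
costOf {suc m} c (true  ∷ F)   = c zero + costOf (λ e → c (suc e)) F
costOf {suc m} c (false ∷ F)   = costOf (λ e → c (suc e)) F

edgeCost : ∀ {n m} → Graph n m → Subset m → ℕ
edgeCost G F = costOf (cost G) F

Joins : ∀ {n m} → Graph n m → Fin m → Fin n → Fin n → Set
Joins G e u v = (src G e ≡ u × tgt G e ≡ v) ⊎ (src G e ≡ v × tgt G e ≡ u)

Adjacent : ∀ {n m} → Graph n m → Fin n → Fin n → Set
Adjacent G u v = ∃[ e ] Joins G e u v

-- G / S (S a set of nodes) is represented on the node set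
-- of G: nodes of S are identified (one may "jump" freely between them),
-- and the edges of G / S are the edges of G not having both ends in S.
-- With S = ⊥ this is G itself.

InsideS : ∀ {n m} → Graph n m → Subset n → Fin m → Set
InsideS G S e = src G e ∈ S × tgt G e ∈ S

data Reach {n m} (G : Graph n m) (S : Subset n) (F : Subset m)
       : Fin n → Fin n → Set where
  here : ∀ {u} → Reach G S F u u
  fwd  : ∀ {e w} → e ∈ F → Reach G S F (tgt G e) w → Reach G S F (src G e) w
  bwd  : ∀ {e w} → e ∈ F → Reach G S F (src G e) w → Reach G S F (tgt G e) w
  jump : ∀ {u u' w} → u ∈ S → u' ∈ S → Reach G S F u' w → Reach G S F u w

Connected : ∀ {n m} → Graph n m → Subset n → Subset m → Set
Connected G S F = ∀ u v → Reach G S F u v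

TwoNodes : ∀ {n m} → Graph n m → Subset n → Set
TwoNodes {n} G S = Σ (Fin n) λ u → Σ (Fin n) λ v → u ≢ v × ¬ (u ∈ S × v ∈ S)

TwoECSS : ∀ {n m} → Graph n m → Subset n → Subset m → Set
TwoECSS G S F =
  TwoNodes G S
  × (∀ e → e ∈ F → ¬ InsideS G S e)
  × Connected G S F
  × (∀ e → e ∈ F → Connected G S (F - e))

IsOpt : ∀ {n m} → Graph n m → Subset n → ℕ → Set
IsOpt {n} {m} G S o =
  (Σ (Subset m) λ F → TwoECSS G S F × edgeCost G F ≡ o)
  × (∀ F → TwoECSS G S F → o ≤ edgeCost G F)

IsMAP : ∀ {n m} → Graph n m → Set
IsMAP G =
  (∀ e → src G e ≢ tgt G e)
  × (∀ e → cost G e ≤ 1)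
  × (∀ e f → e ≢ f → cost G e ≡ 0 → cost G f ≡ 0 →            -- cost-0 edges
        ∀ x → ¬ ((src G e ≡ x ⊎ tgt G e ≡ x)                   -- form a matching
                 × (src G f ≡ x ⊎ tgt G f ≡ x)))
  × TwoECSS G ⊥ ⊤

data ReachAvoid {n m} (G : Graph n m) (x : Fin n) : Fin n → Fin n → Set where
  here : ∀ {u} → u ≢ x → ReachAvoid G x u u
  fwd  : ∀ {e w} → src G e ≢ x → ReachAvoid G x (tgt G e) w → ReachAvoid G x (src G e) w
  bwd  : ∀ {e w} → tgt G e ≢ x → ReachAvoid G x (src G e) w → ReachAvoid G x (tgt G e) w

TwoNodeConnected : ∀ {n m} → Graph n m → Set
TwoNodeConnected {n} G =
  3 ≤ n
  × Connected G ⊥ ⊤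
  × (∀ x u v → u ≢ x → v ≢ x → ReachAvoid G x u v)

next : Fin 4 → Fin 4
next zero                   = suc zero
next (suc zero)             = suc (suc zero)
next (suc (suc zero))       = suc (suc (suc zero))
next (suc (suc (suc zero))) = zero

record FourCycle {n m} (G : Graph n m) : Set where
  field
    node     : Fin 4 → Fin n
    edge     : Fin 4 → Fin m
    nodeInj  : ∀ i j → node i ≡ node j → i ≡ j
    edgeInj  : ∀ i j → edge i ≡ edge j → i ≡ j
    joins    : ∀ i → Joins G (edge i) (node i) (node (next i))
open FourCycle public

cycleCost : ∀ {n m} {G : Graph n m} → FourCycle G → ℕ
cycleCost {G = G} Z = cost G (edge Z zero) + cost G (edge Z (suc zero))
  + cost G (edge Z (suc (suc zero))) + cost G (edge Z (suc (suc (suc zero))))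

OnCycle : ∀ {n m} {G : Graph n m} → Fin n → FourCycle G → Set
OnCycle v Z = ∃[ i ] node Z i ≡ v

Attachment : ∀ {n m} → Graph n m → Subset n → Fin n → Set
Attachment G S a = a ∈ S × ∃[ w ] (w ∉ S × Adjacent G a w)

UnitEdgeCondition : ∀ {n m} (G : Graph n m) → FourCycle G → Fin n → FourCycle G → Set
UnitEdgeCondition G Z a Z' =
  ∀ i → cost G (edge Z i) ≡ 1 → src G (edge Z i) ≢ a → tgt G (edge Z i) ≢ a →
    (∃[ w ] (OnCycle w Z' × Adjacent G (src G (edge Z i)) w))
    × (∃[ w ] (OnCycle w Z' × Adjacent G (tgt G (edge Z i)) w))

-- C (given by its node set; C is the induced subgraph) is an R8 of G
IsR8 : ∀ {n m} → Graph n m → Subset n → Set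
IsR8 {n} G C =
  ∣ C ∣ ≡ 8
  × C ≢ ⊤
  × Σ (FourCycle G) λ C₁ → Σ (FourCycle G) λ C₂ → Σ (Fin n) λ a₁ → Σ (Fin n) λ a₂ →
      (∀ i → node C₁ i ∈ C) × (∀ i → node C₂ i ∈ C)
    × (∀ i j → node C₁ i ≢ node C₂ j)
    × cycleCost C₁ ≡ 2 × cycleCost C₂ ≡ 2
    × OnCycle a₁ C₁ × OnCycle a₂ C₂
    × Attachment G C a₁ × Attachment G C a₂
    × (∀ a → Attachment G C a → a ≡ a₁ ⊎ a ≡ a₂)
    × UnitEdgeCondition G C₁ a₁ C₂
    × UnitEdgeCondition G C₂ a₂ C₁

InE : ∀ {n m} → Graph n m → Subset n → Subset m → Set
InE G C F = ∀ e → e ∈ F → src G e ∈ C × tgt G e ∈ C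

ℕtoℚ : ℕ → ℚ
ℕtoℚ k = (+ k) / 1

WithinBound : ℚ → ℕ → ℕ → Set
WithinBound α c o = ℕtoℚ c Q.≤ (ℕtoℚ o Q.⊔ ((α Q.* ℕtoℚ o) Q.- ℕtoℚ 2))

module Submission where

-- Some unit edge of C₂
-- avoids a₂ (the two edges opposite a₂ share a node, and cost-0 edges form a
-- matching); by the R8 condition both its ends have neighbours w, w' on C₁.
-- F = C₁ + (C₂ minus that edge, joined to w and w') is a cycle with one ear,
-- so F costs at most 2 + 3 = 5 and keeps all of C connected after losing any
-- edge; with a 2-ECSS B of G / C this makes F ∪ B a 2-ECSS of G.  For the
-- ratio, every node of a 2-ECSS H of G meets a unit edge of H, so a greedy
-- edge cover gives opt(G) ≥ n/2 ≥ 6, and H minus its edges inside C is a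
-- 2-ECSS of G / C saving three unit edges at the six non-attachment nodes of
-- C, so opt(G / C) + 3 ≤ opt(G); the arithmetic in ℚ then finishes.

open import Defs
open import Data.Rational using (ℚ; _/_)
import Data.Rational as Q

module Ratio where

  open import Data.Nat as ℕ using (ℕ)
  import Data.Nat.Properties as ℕₚ
  open import Data.Nat.Coprimality as Coprimality using (1-coprimeTo)
  open import Data.Integer as ℤ using (+_)
  import Data.Integer.Properties as ℤₚ
  open import Data.Rational as ℚ using (mkℚ; _+_; _*_; _-_; _≤_)
  import Data.Rational.Properties as ℚₚ
  import Data.Rational.Unnormalised as ℚᵘ
  import Data.Rational.Unnormalised.Properties as ℚᵘₚ
  open import Data.Rational.Solver using (module +-*-Solver)
  open import Data.Sum using (inj₁; inj₂)
  open import Data.Unit using (tt)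
  open import Relation.Binary.PropositionalEquality
  open import Relation.Nullary.Decidable using (toWitness)

  ℕtoℚ-canonical : ∀ k → ℕtoℚ k ≡ mkℚ (+ k) 0 (Coprimality.sym (1-coprimeTo k))
  ℕtoℚ-canonical k = ℚₚ.↥p/↧p≡p (mkℚ (+ k) 0 (Coprimality.sym (1-coprimeTo k)))

  ℕtoℚ-mono : ∀ {a b} → a ℕ.≤ b → ℕtoℚ a ≤ ℕtoℚ b
  ℕtoℚ-mono {a} {b} a≤b rewrite ℕtoℚ-canonical a | ℕtoℚ-canonical b =
    ℚ.*≤* (subst₂ ℤ._≤_ (sym (ℤₚ.*-identityʳ (+ a))) (sym (ℤₚ.*-identityʳ (+ b))) (ℤ.+≤+ a≤b))

  ℕtoℚ-+ : ∀ a b → ℕtoℚ (a ℕ.+ b) ≡ ℕtoℚ a + ℕtoℚ b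
  ℕtoℚ-+ a b = ℚₚ.toℚᵘ-injective (ℚᵘₚ.≃-trans unnormalised (ℚᵘₚ.≃-sym (ℚₚ.toℚᵘ-homo-+ (ℕtoℚ a) (ℕtoℚ b))))
    where
    unnormalised : ℚ.toℚᵘ (ℕtoℚ (a ℕ.+ b)) ℚᵘ.≃ (ℚ.toℚᵘ (ℕtoℚ a) ℚᵘ.+ ℚ.toℚᵘ (ℕtoℚ b))
    unnormalised rewrite ℕtoℚ-canonical (a ℕ.+ b) | ℕtoℚ-canonical a | ℕtoℚ-canonical b =
      ℚᵘ.*≡* (cong (ℤ._* + 1) (trans (ℤₚ.pos-+ a b)
        (cong₂ ℤ._+_ (sym (ℤₚ.*-identityʳ (+ a))) (sym (ℤₚ.*-identityʳ (+ b))))))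

  private
    ⌜_⌝ : ℕ → ℚ
    ⌜_⌝ = ℕtoℚ

    5/3 2/3 : ℚ
    5/3 = + 5 / 3
    2/3 = + 2 / 3

  bound-step : (α : ℚ) (c c' o' o : ℕ) → 5/3 ≤ α → c' ℕ.≤ c ℕ.+ 5 → o' ℕ.+ 3 ℕ.≤ o → 6 ℕ.≤ o →
    WithinBound α c o' → WithinBound α c' o
  bound-step α c c' o' o α≥5/3 c'≤c+5ℕ o'+3≤o 6≤o c-bound = ℚₚ.p≤q⇒p≤r⊔q ⌜ o ⌝ c'-bound
    where
    open ℚₚ.≤-Reasoning
    open +-*-Solver
    instance
      α-nonneg : ℚ.NonNegative α
      α-nonneg = ℚ.nonNegative (ℚₚ.≤-trans (toWitness {a? = ℚ.0ℚ ℚₚ.≤? 5/3} tt) α≥5/3)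
      o-nonneg : ℚ.NonNegative ⌜ o ⌝
      o-nonneg = ℚ.nonNegative (ℕtoℚ-mono {0} {o} ℕ.z≤n)

    c'≤c+5 : ⌜ c' ⌝ ≤ ⌜ c ⌝ + ⌜ 5 ⌝
    c'≤c+5 = ℚₚ.≤-trans (ℕtoℚ-mono c'≤c+5ℕ) (ℚₚ.≤-reflexive (ℕtoℚ-+ c 5))

    regroup : ∀ a p → (a * p - ⌜ 2 ⌝) + ⌜ 5 ⌝ ≡ a * p + (⌜ 5 ⌝ - ⌜ 2 ⌝)
    regroup = solve 2 (λ a p → (a :* p :- con ⌜ 2 ⌝) :+ con ⌜ 5 ⌝ := a :* p :+ (con ⌜ 5 ⌝ :- con ⌜ 2 ⌝)) refl
    factor : ∀ a p → a * p + (a * ⌜ 3 ⌝ - ⌜ 2 ⌝) ≡ a * (p + ⌜ 3 ⌝) - ⌜ 2 ⌝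
    factor = solve 2 (λ a p → a :* p :+ (a :* con ⌜ 3 ⌝ :- con ⌜ 2 ⌝) := a :* (p :+ con ⌜ 3 ⌝) :- con ⌜ 2 ⌝) refl
    split-2 : ∀ p → p + ⌜ 2 ⌝ ≡ (p + 2/3 * ⌜ 6 ⌝) - ⌜ 2 ⌝
    split-2 = solve 1 (λ p → p :+ con ⌜ 2 ⌝ := (p :+ con 2/3 :* con ⌜ 6 ⌝) :- con ⌜ 2 ⌝) refl
    collect : ∀ p → (p + 2/3 * p) - ⌜ 2 ⌝ ≡ 5/3 * p - ⌜ 2 ⌝
    collect = solve 1 (λ p → (p :+ con 2/3 :* p) :- con ⌜ 2 ⌝ := con 5/3 :* p :- con ⌜ 2 ⌝) refl

    from-ratio : ⌜ c ⌝ ≤ α * ⌜ o' ⌝ - ⌜ 2 ⌝ → ⌜ c' ⌝ ≤ α * ⌜ o ⌝ - ⌜ 2 ⌝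
    from-ratio c≤ = begin
      ⌜ c' ⌝                               ≤⟨ c'≤c+5 ⟩
      ⌜ c ⌝ + ⌜ 5 ⌝                        ≤⟨ ℚₚ.+-monoˡ-≤ ⌜ 5 ⌝ c≤ ⟩
      (α * ⌜ o' ⌝ - ⌜ 2 ⌝) + ⌜ 5 ⌝         ≡⟨ regroup α ⌜ o' ⌝ ⟩
      α * ⌜ o' ⌝ + (⌜ 5 ⌝ - ⌜ 2 ⌝)         ≤⟨ ℚₚ.+-monoʳ-≤ (α * ⌜ o' ⌝) (ℚₚ.+-monoˡ-≤ (ℚ.- ⌜ 2 ⌝) 5≤3α) ⟩
      α * ⌜ o' ⌝ + (α * ⌜ 3 ⌝ - ⌜ 2 ⌝)     ≡⟨ factor α ⌜ o' ⌝ ⟩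
      α * (⌜ o' ⌝ + ⌜ 3 ⌝) - ⌜ 2 ⌝         ≡⟨ cong (λ t → α * t - ⌜ 2 ⌝) (sym (ℕtoℚ-+ o' 3)) ⟩
      α * ⌜ o' ℕ.+ 3 ⌝ - ⌜ 2 ⌝             ≤⟨ ℚₚ.+-monoˡ-≤ (ℚ.- ⌜ 2 ⌝) (ℚₚ.*-monoˡ-≤-nonNeg α (ℕtoℚ-mono o'+3≤o)) ⟩
      α * ⌜ o ⌝ - ⌜ 2 ⌝                    ∎
      where
      5≤3α : ⌜ 5 ⌝ ≤ α * ⌜ 3 ⌝
      5≤3α = ℚₚ.*-monoʳ-≤-nonNeg ⌜ 3 ⌝ α≥5/3

    from-opt : ⌜ c ⌝ ≤ ⌜ o' ⌝ → ⌜ c' ⌝ ≤ α * ⌜ o ⌝ - ⌜ 2 ⌝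
    from-opt c≤ = begin
      ⌜ c' ⌝                               ≤⟨ c'≤c+5 ⟩
      ⌜ c ⌝ + ⌜ 5 ⌝                        ≤⟨ ℚₚ.+-monoˡ-≤ ⌜ 5 ⌝ c≤ ⟩
      ⌜ o' ⌝ + ⌜ 5 ⌝                       ≡⟨ sym (ℕtoℚ-+ o' 5) ⟩
      ⌜ o' ℕ.+ 5 ⌝                         ≤⟨ ℕtoℚ-mono o'+5≤o+2 ⟩
      ⌜ o ℕ.+ 2 ⌝                          ≡⟨ ℕtoℚ-+ o 2 ⟩
      ⌜ o ⌝ + ⌜ 2 ⌝                        ≡⟨ split-2 ⌜ o ⌝ ⟩
      (⌜ o ⌝ + 2/3 * ⌜ 6 ⌝) - ⌜ 2 ⌝        ≤⟨ ℚₚ.+-monoˡ-≤ (ℚ.- ⌜ 2 ⌝) (ℚₚ.+-monoʳ-≤ ⌜ o ⌝ (ℚₚ.*-monoˡ-≤-nonNeg 2/3 (ℕtoℚ-mono 6≤o))) ⟩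
      (⌜ o ⌝ + 2/3 * ⌜ o ⌝) - ⌜ 2 ⌝        ≡⟨ collect ⌜ o ⌝ ⟩
      5/3 * ⌜ o ⌝ - ⌜ 2 ⌝                  ≤⟨ ℚₚ.+-monoˡ-≤ (ℚ.- ⌜ 2 ⌝) (ℚₚ.*-monoʳ-≤-nonNeg ⌜ o ⌝ α≥5/3) ⟩
      α * ⌜ o ⌝ - ⌜ 2 ⌝                    ∎
      where
      o'+5≤o+2 : o' ℕ.+ 5 ℕ.≤ o ℕ.+ 2
      o'+5≤o+2 = ℕₚ.≤-trans (ℕₚ.≤-reflexive (sym (ℕₚ.+-assoc o' 3 2))) (ℕₚ.+-monoˡ-≤ 2 o'+3≤o)

    c'-bound : ⌜ c' ⌝ ≤ α * ⌜ o ⌝ - ⌜ 2 ⌝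
    c'-bound with ℚₚ.≤-total ⌜ o' ⌝ (α * ⌜ o' ⌝ - ⌜ 2 ⌝)
    ... | inj₁ o'≤ = from-ratio (subst (⌜ c ⌝ ≤_) (ℚₚ.p≤q⇒p⊔q≡q o'≤) c-bound)
    ... | inj₂ o'≥ = from-opt (subst (⌜ c ⌝ ≤_) (ℚₚ.p≥q⇒p⊔q≡p o'≥) c-bound)

open Ratio using (bound-step)

import Data.Nat.Properties as ℕₚ
open import Algebra.Properties.CommutativeSemigroup ℕₚ.+-commutativeSemigroup using (x∙yz≈y∙xz)
open import Data.Bool using (true; false)
open import Data.Empty using (⊥-elim)
open import Data.Fin using (Fin; zero; suc; _≟_)
open import Data.Fin.Properties using (all?; ¬∀⟶∃¬)
open import Data.Fin.Subset using (Subset; _∈_; _∉_; _-_; _─_; ⊥; ⊤; ∣_∣; _∪_; _⊆_; _⊂_; ⁅_⁆)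
open import Data.Fin.Subset.Induction using (⊂-wellFounded; Acc; acc)
open import Data.Fin.Subset.Properties
  using (_∈?_; ∉⊥; ⊥⊆; ∈⊤; x∈⁅x⁆; x∈⁅y⁆⇒x≡y; ∣⁅x⁆∣≡1; ∣⊥∣≡0; ∣⊤∣≡n; drop-∷-⊆; ⊆-antisym; ⊆-⊂-trans;
         ∪-identityʳ; p⊆p∪q; q⊆p∪q; x∈p∪q⁻; x∈p∪q⁺; p─q⊆p; x∈p∧x≢y⇒x∈p-y; x∈p⇒p-x⊂p; x∈p⇒∣p-x∣<∣p∣;
         nonempty?; Empty-unique)
open import Data.List using (List; []; _∷_; length; map; foldr; _++_; allFin)
open import Data.List.Membership.DecPropositional as DecMembership using ()
open import Data.List.Membership.Propositional using () renaming (_∈_ to _∈ₗ_)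
open import Data.List.Membership.Propositional.Properties using (∈-map⁻; ∈-++⁻; ∈-++⁺ˡ; ∈-++⁺ʳ)
open import Data.List.Properties using (map-++)
open import Data.List.Relation.Unary.All as All using (All; []; _∷_)
open import Data.List.Relation.Unary.All.Properties using (++⁺; ¬Any⇒All¬)
open import Data.List.Relation.Unary.AllPairs using (AllPairs; []; _∷_; allPairs?)
open import Data.List.Relation.Unary.Any using (here; there)
import Data.List.Relation.Unary.Unique.Propositional.Properties as Unique
open import Data.Nat as ℕ using (ℕ; zero; suc; _+_; _*_; _≤_; z≤n; s≤s)
open import Data.Nat.ListAction using (sum)
open import Data.Nat.ListAction.Properties using (sum-++)
open import Data.Nat.Tactic.RingSolver using (solve-∀)
open import Data.Product using (Σ; _×_; _,_; proj₁; proj₂)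
import Data.Rational.Properties as ℚₚ
open import Data.Sum using (_⊎_; inj₁; inj₂; [_,_]′)
import Data.Sum
open import Data.Vec using (tabulate; []; _∷_; here; there)
open import Data.Vec.Properties using (lookup⇒[]=; []=⇒lookup; lookup∘tabulate)
open import Function using (id)
open import Relation.Binary.PropositionalEquality
open import Relation.Nullary using (¬_; Dec; yes; no; does; ¬?)
open import Relation.Nullary.Decidable using (dec-true; from-yes; _×-dec_; decidable-stable)

∈─⇒∉ : ∀ {k} {x : Fin k} (p q : Subset k) → x ∈ p ─ q → x ∉ q
∈─⇒∉ (_ ∷ p) (true  ∷ q) (there h) (there h') = ∈─⇒∉ p q h h'
∈─⇒∉ (_ ∷ p) (false ∷ q) (there h) (there h') = ∈─⇒∉ p q h h'

∈-remove⁻ : ∀ {k} {x y : Fin k} {p : Subset k} → x ∈ p - y → x ∈ p × x ≢ y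
∈-remove⁻ {y = y} {p} h = p─q⊆p p ⁅ y ⁆ h , λ { refl → ∈─⇒∉ p ⁅ y ⁆ h (x∈⁅x⁆ y) }

p-x-y⊆p : ∀ {k} {p : Subset k} {x y} → p - x - y ⊆ p
p-x-y⊆p h = proj₁ (∈-remove⁻ (proj₁ (∈-remove⁻ h)))

all-remove : ∀ {k} {p : Subset k} {x xs} → All (_∈ p) xs → All (x ≢_) xs → All (_∈ p - x) xs
all-remove xs⊆p x∉xs = All.zipWith (λ (y∈p , x≢y) → x∈p∧x≢y⇒x∈p-y y∈p (≢-sym x≢y)) (xs⊆p , x∉xs)

∣p∣≤∣p─q∣+∣q∣ : ∀ {k} (p q : Subset k) → ∣ p ∣ ≤ ∣ p ─ q ∣ + ∣ q ∣
∣p∣≤∣p─q∣+∣q∣ []          []          = z≤n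
∣p∣≤∣p─q∣+∣q∣ (true  ∷ p) (true  ∷ q) = ℕₚ.≤-trans (s≤s (∣p∣≤∣p─q∣+∣q∣ p q)) (ℕₚ.≤-reflexive (sym (ℕₚ.+-suc _ _)))
∣p∣≤∣p─q∣+∣q∣ (false ∷ p) (true  ∷ q) = ℕₚ.≤-trans (∣p∣≤∣p─q∣+∣q∣ p q) (ℕₚ.+-monoʳ-≤ _ (ℕₚ.n≤1+n _))
∣p∣≤∣p─q∣+∣q∣ (true  ∷ p) (false ∷ q) = s≤s (∣p∣≤∣p─q∣+∣q∣ p q)
∣p∣≤∣p─q∣+∣q∣ (false ∷ p) (false ∷ q) = ∣p∣≤∣p─q∣+∣q∣ p q

∣p∣≤∣p-x∣+1 : ∀ {k} (p : Subset k) x → ∣ p ∣ ≤ ∣ p - x ∣ + 1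
∣p∣≤∣p-x∣+1 p x = subst (λ t → ∣ p ∣ ≤ ∣ p - x ∣ + t) (∣⁅x⁆∣≡1 x) (∣p∣≤∣p─q∣+∣q∣ p ⁅ x ⁆)

∣p∣≤∣p-x-y∣+2 : ∀ {k} (p : Subset k) x y → ∣ p ∣ ≤ ∣ p - x - y ∣ + 2
∣p∣≤∣p-x-y∣+2 p x y = begin
  ∣ p ∣                 ≤⟨ ∣p∣≤∣p-x∣+1 p x ⟩
  ∣ p - x ∣ + 1         ≤⟨ ℕₚ.+-monoˡ-≤ 1 (∣p∣≤∣p-x∣+1 (p - x) y) ⟩
  ∣ p - x - y ∣ + 1 + 1 ≡⟨ ℕₚ.+-assoc _ 1 1 ⟩
  ∣ p - x - y ∣ + 2     ∎
  where open ℕₚ.≤-Reasoning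

module _ {k} {P : Fin k → Set} (P? : ∀ i → Dec (P i)) where

  select : Subset k
  select = tabulate (λ i → does (P? i))

  ∈-select⁺ : ∀ {i} → P i → i ∈ select
  ∈-select⁺ {i} p = lookup⇒[]= i select (trans (lookup∘tabulate _ i) (dec-true (P? i) p))

  ∈-select⁻ : ∀ {i} → i ∈ select → P i
  ∈-select⁻ {i} h with P? i | trans (sym (lookup∘tabulate (λ j → does (P? j)) i)) ([]=⇒lookup h)
  ... | yes p | _  = p
  ... | no  _ | ()

costOf-⊥ : ∀ {m} (c : Fin m → ℕ) → costOf c ⊥ ≡ 0
costOf-⊥ {zero}  c = refl
costOf-⊥ {suc m} c = costOf-⊥ (λ e → c (suc e))

costOf-⁅⁆ : ∀ {m} (c : Fin m → ℕ) x → costOf c ⁅ x ⁆ ≡ c x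
costOf-⁅⁆ {suc m} c zero    = trans (cong (c zero +_) (costOf-⊥ (λ e → c (suc e)))) (ℕₚ.+-identityʳ _)
costOf-⁅⁆ {suc m} c (suc x) = costOf-⁅⁆ (λ e → c (suc e)) x

costOf-∪ : ∀ {m} (c : Fin m → ℕ) p q → costOf c (p ∪ q) ≤ costOf c p + costOf c q
costOf-∪ {zero}  c []          []          = z≤n
costOf-∪ {suc m} c (true  ∷ p) (true  ∷ q) = begin
  c zero + costOf _ (p ∪ q)                   ≤⟨ ℕₚ.+-monoʳ-≤ (c zero) (costOf-∪ _ p q) ⟩
  c zero + (costOf _ p + costOf _ q)          ≤⟨ ℕₚ.+-monoʳ-≤ (c zero) (ℕₚ.+-monoʳ-≤ (costOf _ p) (ℕₚ.m≤n+m _ (c zero))) ⟩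
  c zero + (costOf _ p + (c zero + costOf _ q)) ≡⟨ sym (ℕₚ.+-assoc (c zero) _ _) ⟩
  c zero + costOf _ p + (c zero + costOf _ q) ∎
  where open ℕₚ.≤-Reasoning
costOf-∪ {suc m} c (true  ∷ p) (false ∷ q) =
  ℕₚ.≤-trans (ℕₚ.+-monoʳ-≤ (c zero) (costOf-∪ _ p q)) (ℕₚ.≤-reflexive (sym (ℕₚ.+-assoc (c zero) _ _)))
costOf-∪ {suc m} c (false ∷ p) (true  ∷ q) =
  ℕₚ.≤-trans (ℕₚ.+-monoʳ-≤ (c zero) (costOf-∪ _ p q)) (ℕₚ.≤-reflexive (x∙yz≈y∙xz (c zero) (costOf _ p) (costOf _ q)))
costOf-∪ {suc m} c (false ∷ p) (false ∷ q) = costOf-∪ _ p q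

costOf-mono : ∀ {m} (c : Fin m → ℕ) {p q} → p ⊆ q → costOf c p ≤ costOf c q
costOf-mono {zero}  c {[]}        {[]}        s = z≤n
costOf-mono {suc m} c {true  ∷ p} {true  ∷ q} s = ℕₚ.+-monoʳ-≤ (c zero) (costOf-mono _ (drop-∷-⊆ s))
costOf-mono {suc m} c {true  ∷ p} {false ∷ q} s with s here
... | ()
costOf-mono {suc m} c {false ∷ p} {true  ∷ q} s = ℕₚ.≤-trans (costOf-mono _ (drop-∷-⊆ s)) (ℕₚ.m≤n+m _ (c zero))
costOf-mono {suc m} c {false ∷ p} {false ∷ q} s = costOf-mono _ (drop-∷-⊆ s)

costOf-insert : ∀ {m} (c : Fin m → ℕ) p x → x ∉ p → costOf c (p ∪ ⁅ x ⁆) ≡ costOf c p + c x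
costOf-insert {suc m} c (true  ∷ p) zero    x∉p = ⊥-elim (x∉p here)
costOf-insert {suc m} c (false ∷ p) zero    x∉p =
  trans (cong (λ r → c zero + costOf _ r) (∪-identityʳ p)) (ℕₚ.+-comm (c zero) _)
costOf-insert {suc m} c (true  ∷ p) (suc x) x∉p =
  trans (cong (c zero +_) (costOf-insert _ p x (λ h → x∉p (there h)))) (sym (ℕₚ.+-assoc (c zero) _ _))
costOf-insert {suc m} c (false ∷ p) (suc x) x∉p = costOf-insert _ p x (λ h → x∉p (there h))

unitEdges-cost : ∀ {m} (c : Fin m → ℕ) {p q : Subset m} (es : List (Fin m)) → p ⊆ q → AllPairs _≢_ es →
  All (λ e → e ∈ q × e ∉ p × c e ≡ 1) es → costOf c p + length es ≤ costOf c q
unitEdges-cost c {p} {q} []       p⊆q []        []  =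
  ℕₚ.≤-trans (ℕₚ.≤-reflexive (ℕₚ.+-identityʳ _)) (costOf-mono c p⊆q)
unitEdges-cost c {p} {q} (e ∷ es) p⊆q (e∉es ∷ distinct) ((e∈q , e∉p , ce≡1) ∷ rest) = begin
  costOf c p + suc (length es)       ≡⟨ ℕₚ.+-suc _ _ ⟩
  suc (costOf c p) + length es       ≡⟨ cong (_+ length es) (ℕₚ.+-comm 1 (costOf c p)) ⟩
  costOf c p + 1 + length es         ≡⟨ cong (λ t → costOf c p + t + length es) (sym ce≡1) ⟩
  costOf c p + c e + length es       ≡⟨ cong (_+ length es) (sym (costOf-insert c p e e∉p)) ⟩
  costOf c (p ∪ ⁅ e ⁆) + length es   ≤⟨ unitEdges-cost c es p∪e⊆q distinct (All.zipWith grow (e∉es , rest)) ⟩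
  costOf c q                         ∎
  where
  open ℕₚ.≤-Reasoning
  p∪e⊆q : p ∪ ⁅ e ⁆ ⊆ q
  p∪e⊆q h with x∈p∪q⁻ p ⁅ e ⁆ h
  ... | inj₁ h∈p = p⊆q h∈p
  ... | inj₂ h∈e rewrite x∈⁅y⁆⇒x≡y e h∈e = e∈q
  grow : ∀ {f} → e ≢ f × (f ∈ q × f ∉ p × c f ≡ 1) → f ∈ q × f ∉ p ∪ ⁅ e ⁆ × c f ≡ 1
  grow {f} (e≢f , f∈q , f∉p , cf≡1) = f∈q , f∉p∪e , cf≡1
    where
    f∉p∪e : f ∉ p ∪ ⁅ e ⁆
    f∉p∪e h with x∈p∪q⁻ p ⁅ e ⁆ h
    ... | inj₁ f∈p = f∉p f∈p
    ... | inj₂ f∈e = e≢f (sym (x∈⁅y⁆⇒x≡y e f∈e))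

setOf : ∀ {m} → List (Fin m) → Subset m
setOf = foldr (λ e F → ⁅ e ⁆ ∪ F) ⊥

∈-setOf⁺ : ∀ {m} {e : Fin m} {es} → e ∈ₗ es → e ∈ setOf es
∈-setOf⁺ {es = f ∷ es} (here refl) = x∈p∪q⁺ (inj₁ (x∈⁅x⁆ f))
∈-setOf⁺ {es = f ∷ es} (there h)   = x∈p∪q⁺ (inj₂ (∈-setOf⁺ h))

∈-setOf⁻ : ∀ {m} {e : Fin m} es → e ∈ setOf es → e ∈ₗ es
∈-setOf⁻ []       h = ⊥-elim (∉⊥ h)
∈-setOf⁻ (f ∷ es) h with x∈p∪q⁻ ⁅ f ⁆ (setOf es) h
... | inj₁ h∈f  = here (x∈⁅y⁆⇒x≡y f h∈f)
... | inj₂ h∈es = there (∈-setOf⁻ es h∈es)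

costOf-setOf : ∀ {m} (c : Fin m → ℕ) es → costOf c (setOf es) ≤ sum (map c es)
costOf-setOf c []       = ℕₚ.≤-reflexive (costOf-⊥ c)
costOf-setOf c (e ∷ es) = ℕₚ.≤-trans (costOf-∪ c ⁅ e ⁆ (setOf es))
  (ℕₚ.+-mono-≤ (ℕₚ.≤-reflexive (costOf-⁅⁆ c e)) (costOf-setOf c es))

module _ {n m} (G : Graph n m) where

  Incident : Fin m → Fin n → Set
  Incident e v = Σ (Fin n) λ w → Joins G e v w

  joins-sym : ∀ {e a b} → Joins G e a b → Joins G e b a
  joins-sym (inj₁ (s , t)) = inj₂ (s , t)
  joins-sym (inj₂ (s , t)) = inj₁ (s , t)

  joins-inside : ∀ {S e a b} → Joins G e a b → a ∈ S → b ∈ S → InsideS G S e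
  joins-inside (inj₁ (refl , refl)) a∈S b∈S = a∈S , b∈S
  joins-inside (inj₂ (refl , refl)) a∈S b∈S = b∈S , a∈S

  joins-avoid : ∀ {e a b t} → Joins G e a b → a ≢ t → b ≢ t → src G e ≢ t × tgt G e ≢ t
  joins-avoid (inj₁ (refl , refl)) a≢t b≢t = a≢t , b≢t
  joins-avoid (inj₂ (refl , refl)) a≢t b≢t = b≢t , a≢t

  joins-touch : ∀ {e a b} → Joins G e a b → src G e ≡ a ⊎ tgt G e ≡ a
  joins-touch (inj₁ (s≡a , _)) = inj₁ s≡a
  joins-touch (inj₂ (_ , t≡a)) = inj₂ t≡a

  ends-of : ∀ {P : Fin n → Set} {e a b} → Joins G e a b → P (src G e) → P (tgt G e) → P a × P b
  ends-of (inj₁ (refl , refl)) Ps Pt = Ps , Pt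
  ends-of (inj₂ (refl , refl)) Ps Pt = Pt , Ps

  joins-end : ∀ {e a b c d} → Joins G e a b → Joins G e c d → c ≡ a ⊎ c ≡ b
  joins-end (inj₁ (refl , refl)) (inj₁ (refl , refl)) = inj₁ refl
  joins-end (inj₁ (refl , refl)) (inj₂ (refl , refl)) = inj₂ refl
  joins-end (inj₂ (refl , refl)) (inj₁ (refl , refl)) = inj₂ refl
  joins-end (inj₂ (refl , refl)) (inj₂ (refl , refl)) = inj₁ refl

  edges-differ : ∀ {e f a b c d} → Joins G e a b → Joins G f c d → a ≢ c → a ≢ d → e ≢ f
  edges-differ jab jcd a≢c a≢d refl with joins-end jcd jab
  ... | inj₁ a≡c = a≢c a≡c
  ... | inj₂ a≡d = a≢d a≡d

  reach-trans : ∀ {S K u v w} → Reach G S K u v → Reach G S K v w → Reach G S K u w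
  reach-trans here         r = r
  reach-trans (fwd e q)    r = fwd e (reach-trans q r)
  reach-trans (bwd e q)    r = bwd e (reach-trans q r)
  reach-trans (jump a b q) r = jump a b (reach-trans q r)

  reach-sym : ∀ {S K u v} → Reach G S K u v → Reach G S K v u
  reach-sym here         = here
  reach-sym (fwd e q)    = reach-trans (reach-sym q) (bwd e here)
  reach-sym (bwd e q)    = reach-trans (reach-sym q) (fwd e here)
  reach-sym (jump a b q) = reach-trans (reach-sym q) (jump b a here)

  reach-mono : ∀ {S K K' u v} → K ⊆ K' → Reach G S K u v → Reach G S K' u v
  reach-mono K⊆K' here         = here
  reach-mono K⊆K' (fwd e q)    = fwd (K⊆K' e) (reach-mono K⊆K' q)
  reach-mono K⊆K' (bwd e q)    = bwd (K⊆K' e) (reach-mono K⊆K' q)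
  reach-mono K⊆K' (jump a b q) = jump a b (reach-mono K⊆K' q)

  reach-edge : ∀ {S K e a b} → e ∈ K → Joins G e a b → Reach G S K a b
  reach-edge e∈K (inj₁ (refl , refl)) = fwd e∈K here
  reach-edge e∈K (inj₂ (refl , refl)) = bwd e∈K here

  reach-expand : ∀ {S B K u v} → (∀ c c' → c ∈ S → c' ∈ S → Reach G ⊥ K c c') → B ⊆ K →
    Reach G S B u v → Reach G ⊥ K u v
  reach-expand S-conn B⊆K here         = here
  reach-expand S-conn B⊆K (fwd e q)    = fwd (B⊆K e) (reach-expand S-conn B⊆K q)
  reach-expand S-conn B⊆K (bwd e q)    = bwd (B⊆K e) (reach-expand S-conn B⊆K q)
  reach-expand S-conn B⊆K (jump a b q) = reach-trans (S-conn _ _ a b) (reach-expand S-conn B⊆K q)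

  reach-contract : ∀ {S K K' u v} → (∀ e → e ∈ K → InsideS G S e ⊎ e ∈ K') →
    Reach G ⊥ K u v → Reach G S K' u v
  reach-contract split here = here
  reach-contract split (fwd {e} e∈K q) with split e e∈K
  ... | inj₁ (s∈S , t∈S) = jump s∈S t∈S (reach-contract split q)
  ... | inj₂ e∈K'        = fwd e∈K' (reach-contract split q)
  reach-contract split (bwd {e} e∈K q) with split e e∈K
  ... | inj₁ (s∈S , t∈S) = jump t∈S s∈S (reach-contract split q)
  ... | inj₂ e∈K'        = bwd e∈K' (reach-contract split q)
  reach-contract split (jump a∈⊥ _ q) = ⊥-elim (∉⊥ a∈⊥)

  first-edge : ∀ {K u v} → Reach G ⊥ K u v → u ≢ v → Σ (Fin m) λ e → e ∈ K × Σ (Fin n) λ w → Joins G e u w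
  first-edge here           u≢v = ⊥-elim (u≢v refl)
  first-edge (fwd {e} e∈K q) _  = e , e∈K , _ , inj₁ (refl , refl)
  first-edge (bwd {e} e∈K q) _  = e , e∈K , _ , inj₂ (refl , refl)
  first-edge (jump a∈⊥ _ q)  _  = ⊥-elim (∉⊥ a∈⊥)

  data Path : Fin n → Fin n → List (Fin m) → Set where
    []  : ∀ {a} → Path a a []
    _∷_ : ∀ {e a c b es} → Joins G e a c → Path c b es → Path a b (e ∷ es)

  OnPath : ∀ {a b es} → Fin n → Path a b es → Set
  OnPath {a} v []      = v ≡ a
  OnPath {a} v (_ ∷ p) = v ≡ a ⊎ OnPath v p

  path-end : ∀ {a b es} (p : Path a b es) → OnPath b p
  path-end []      = refl
  path-end (_ ∷ p) = inj₂ (path-end p)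

  path-reach : ∀ {S K a b es} → Path a b es → All (_∈ K) es → Reach G S K a b
  path-reach []      []          = here
  path-reach (j ∷ p) (e∈K ∷ es⊆K) = reach-trans (reach-edge e∈K j) (path-reach p es⊆K)

  path-start : ∀ {a b es} (p : Path a b es) → OnPath a p
  path-start []      = refl
  path-start (_ ∷ _) = inj₁ refl

  path-edge-ends : ∀ {a b es e} (p : Path a b es) → e ∈ₗ es → OnPath (src G e) p × OnPath (tgt G e) p
  path-edge-ends (inj₁ (refl , refl) ∷ p) (here refl) = inj₁ refl , inj₂ (path-start p)
  path-edge-ends (inj₂ (refl , refl) ∷ p) (here refl) = inj₂ (path-start p) , inj₁ refl
  path-edge-ends (_ ∷ p) (there e∈es) = let (s , t) = path-edge-ends p e∈es in inj₂ s , inj₂ t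

  path-split : ∀ {S F a b es} (p : Path a b es) → AllPairs _≢_ es → All (_∈ F) es →
    ∀ x {v} → OnPath v p → Reach G S (F - x) v a ⊎ Reach G S (F - x) v b
  path-split []      _ _ x refl        = inj₁ here
  path-split (j ∷ p) _ _ x (inj₁ refl) = inj₁ here
  path-split (_∷_ {e} j p) (e∉es ∷ distinct) (e∈F ∷ es⊆F) x (inj₂ v∈p)
    with path-split p distinct es⊆F x v∈p
  ... | inj₂ v→b = inj₂ v→b
  ... | inj₁ v→c with e ≟ x
  ...   | yes refl = inj₂ (reach-trans v→c (path-reach p (all-remove es⊆F e∉es)))
  ...   | no e≢x   = inj₁ (reach-trans v→c (reach-sym (reach-edge (x∈p∧x≢y⇒x∈p-y e∈F e≢x) j)))

  ear-split : ∀ {S F u v w w' es g h} (p : Path u v es) → AllPairs _≢_ es → All (_∈ F) es →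
    Joins G g u w → Joins G h v w' → g ∈ F → h ∈ F → g ≢ h → All (g ≢_) es → All (h ≢_) es →
    ∀ x {t} → OnPath t p → Reach G S (F - x) t w ⊎ Reach G S (F - x) t w'
  ear-split {S} {F} {u} {v} {g = g} {h} p distinct es⊆F jg jh g∈F h∈F g≢h g∉es h∉es x {t} t∈p with g ≟ x | h ≟ x
  ... | yes refl | _ = inj₂ (reach-trans t→v (reach-edge (x∈p∧x≢y⇒x∈p-y h∈F (≢-sym g≢h)) jh))
    where
    whole : Reach G S (F - x) u v
    whole = path-reach p (all-remove es⊆F g∉es)
    t→v : Reach G S (F - x) t v
    t→v with path-split p distinct es⊆F x t∈p
    ... | inj₁ t→u = reach-trans t→u whole
    ... | inj₂ t→v = t→v
  ... | no g≢x | yes refl = inj₁ (reach-trans t→u (reach-edge (x∈p∧x≢y⇒x∈p-y g∈F g≢x) jg))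
    where
    whole : Reach G S (F - x) u v
    whole = path-reach p (all-remove es⊆F h∉es)
    t→u : Reach G S (F - x) t u
    t→u with path-split p distinct es⊆F x t∈p
    ... | inj₁ t→u = t→u
    ... | inj₂ t→v = reach-trans t→v (reach-sym whole)
  ... | no g≢x | no h≢x with path-split p distinct es⊆F x t∈p
  ...   | inj₁ t→u = inj₁ (reach-trans t→u (reach-edge (x∈p∧x≢y⇒x∈p-y g∈F g≢x) jg))
  ...   | inj₂ t→v = inj₂ (reach-trans t→v (reach-edge (x∈p∧x≢y⇒x∈p-y h∈F h≢x) jh))

  path-inside : ∀ {S a b es} (p : Path a b es) → (∀ {v} → OnPath v p → v ∈ S) → All (InsideS G S) es
  path-inside p nodes-in = All.tabulate λ e∈es → let (s , t) = path-edge-ends p e∈es in nodes-in s , nodes-in t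

  edge-off-path : ∀ {a b es e u t} (p : Path a b es) → Joins G e u t → ¬ OnPath t p → All (e ≢_) es
  edge-off-path p jut t∉p = All.tabulate λ { e∈es refl → t∉p (end-on (joins-touch (joins-sym jut)) (path-edge-ends p e∈es)) }
    where
    end-on : ∀ {e t} → src G e ≡ t ⊎ tgt G e ≡ t → OnPath (src G e) p × OnPath (tgt G e) p → OnPath t p
    end-on (inj₁ refl) (s , _) = s
    end-on (inj₂ refl) (_ , t) = t

distinct-length : ∀ {k} (p : Subset k) xs → AllPairs _≢_ xs → All (_∈ p) xs → length xs ≤ ∣ p ∣
distinct-length p []       []                  []            = z≤n
distinct-length p (x ∷ xs) (x∉xs ∷ distinct) (x∈p ∷ xs⊆p) = ℕₚ.≤-trans
  (s≤s (distinct-length (p - x) xs distinct (all-remove xs⊆p x∉xs)))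
  (x∈p⇒∣p-x∣<∣p∣ x∈p)

distinct-complete : ∀ {k} (p : Subset k) {xs} → AllPairs _≢_ xs → All (_∈ p) xs → ∣ p ∣ ≤ length xs →
  ∀ {i} → i ∈ p → i ∈ₗ xs
distinct-complete p {xs} distinct xs⊆p full {i} i∈p with DecMembership._∈?_ _≟_ i xs
... | yes i∈xs = i∈xs
... | no  i∉xs = ⊥-elim (ℕₚ.<-irrefl refl (ℕₚ.≤-trans
  (distinct-length p (i ∷ xs) (¬Any⇒All¬ xs i∉xs ∷ distinct) (i∈p ∷ xs⊆p)) full))

module _ {n m} (G : Graph n m) (P : Fin m → Set) where

  Meets : Subset n → Fin m → Set
  Meets X e = Σ (Fin n) λ t → t ∈ X × Incident G e t

  -- Greedy edge cover: while X is nonempty, pick v ∈ X and a P-edge vw, and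
  -- continue with X - v - w.  The edges picked are distinct (each later edge
  -- meets X - v - w, so it is not vw), and at least ∣ X ∣ / 2 in number.
  greedy-cover : ∀ X → Acc _⊂_ X → (∀ v → v ∈ X → Σ (Fin m) λ e → P e × Incident G e v) →
    Σ (List (Fin m)) λ es → AllPairs _≢_ es × All P es × All (Meets X) es × ∣ X ∣ ≤ 2 * length es
  greedy-cover X (acc smaller) cover with nonempty? X
  ... | no X-empty = [] , [] , [] , [] , ℕₚ.≤-reflexive (trans (cong ∣_∣ (Empty-unique X-empty)) (∣⊥∣≡0 n))
  ... | yes (v , v∈X) with cover v v∈X
  ...   | e , Pe , w , jvw with greedy-cover (X - v - w) (smaller X'⊂X) (λ t t∈X' → cover t (p-x-y⊆p t∈X'))
    where
    X'⊂X : X - v - w ⊂ X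
    X'⊂X = ⊆-⊂-trans (p─q⊆p (X - v) ⁅ w ⁆) (x∈p⇒p-x⊂p v∈X)
  ...     | es , distinct , Pes , meets , size =
    e ∷ es , All.map new meets ∷ distinct , Pe ∷ Pes ,
    (v , v∈X , w , jvw) ∷ All.map (λ (t , t∈X' , inc) → t , p-x-y⊆p t∈X' , inc) meets ,
    ℕₚ.≤-trans (∣p∣≤∣p-x-y∣+2 X v w) (ℕₚ.≤-trans (ℕₚ.+-monoˡ-≤ 2 size) (ℕₚ.≤-reflexive two-more))
    where
    new : ∀ {f} → Meets (X - v - w) f → e ≢ f
    new (t , t∈X' , _ , jt) refl with ∈-remove⁻ t∈X' | joins-end G jvw jt
    ... | t∈X-v , t≢w | inj₂ t≡w = t≢w t≡w
    ... | t∈X-v , t≢w | inj₁ t≡v = proj₂ (∈-remove⁻ t∈X-v) t≡v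
    two-more : 2 * length es + 2 ≡ 2 * suc (length es)
    two-more = trans (ℕₚ.+-comm (2 * length es) 2) (sym (ℕₚ.*-suc 2 (length es)))

  edge-cover : (X : Subset n) → (∀ v → v ∈ X → Σ (Fin m) λ e → P e × Incident G e v) →
    Σ (List (Fin m)) λ es → AllPairs _≢_ es × All P es × ∣ X ∣ ≤ 2 * length es
  edge-cover X cover with greedy-cover X (⊂-wellFounded X) cover
  ... | es , distinct , Pes , _ , size = es , distinct , Pes , size

unit-edge-cover : ∀ {n m} (G : Graph n m) (X : Subset n) {p q : Subset m} → p ⊆ q →
  (∀ v → v ∈ X → Σ (Fin m) λ e → (e ∈ q × e ∉ p × cost G e ≡ 1) × Incident G e v) →
  ∣ X ∣ + 2 * edgeCost G p ≤ 2 * edgeCost G q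
unit-edge-cover G X {p} {q} p⊆q cover with edge-cover G _ X cover
... | es , distinct , unit , size = begin
  ∣ X ∣ + 2 * edgeCost G p             ≤⟨ ℕₚ.+-monoˡ-≤ _ size ⟩
  2 * length es + 2 * edgeCost G p     ≡⟨ trans (ℕₚ.+-comm (2 * length es) _) (sym (ℕₚ.*-distribˡ-+ 2 (edgeCost G p) _)) ⟩
  2 * (edgeCost G p + length es)       ≤⟨ ℕₚ.*-monoʳ-≤ 2 (unitEdges-cost (cost G) es p⊆q distinct unit) ⟩
  2 * edgeCost G q                     ∎
  where open ℕₚ.≤-Reasoning

zero-or-one : ∀ {c} → c ≤ 1 → c ≡ 0 ⊎ c ≡ 1
zero-or-one z≤n       = inj₁ refl
zero-or-one (s≤s z≤n) = inj₂ refl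

module _ {n m} (G : Graph n m) where

  joins-distinct : (∀ e → src G e ≢ tgt G e) → ∀ {e a b} → Joins G e a b → a ≢ b
  joins-distinct loopless {e} (inj₁ (refl , refl)) = loopless e
  joins-distinct loopless {e} (inj₂ (refl , refl)) = ≢-sym (loopless e)

  -- In a MAP instance every node of a 2-ECSS H of G meets a unit edge of H:
  -- it meets two distinct edges of H, and the cost-0 edges form a matching.
  unit-edge-at : IsMAP G → ∀ {H} → TwoECSS G ⊥ H → ∀ v → Σ (Fin m) λ e → (e ∈ H × cost G e ≡ 1) × Incident G e v
  unit-edge-at (loopless , cost≤1 , matching , _) {H} ((u₁ , u₂ , u₁≢u₂ , _) , _ , connected , robust) v
    with first-edge G (connected v other) v≢other
    where
    other : Fin n
    other with v ≟ u₁
    ... | yes _ = u₂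
    ... | no  _ = u₁
    v≢other : v ≢ other
    v≢other with v ≟ u₁
    ... | yes refl = u₁≢u₂
    ... | no  v≢u₁ = v≢u₁
  ... | e₁ , e₁∈H , w , j₁ with first-edge G (robust e₁ e₁∈H v w) (joins-distinct loopless j₁)
  ...   | e₂ , e₂∈H-e₁ , w₂ , j₂ with ∈-remove⁻ e₂∈H-e₁ | zero-or-one (cost≤1 e₁) | zero-or-one (cost≤1 e₂)
  ...     | _    , _     | inj₂ unit₁ | _          = e₁ , (e₁∈H , unit₁) , w , j₁
  ...     | e₂∈H , _     | inj₁ _     | inj₂ unit₂ = e₂ , (e₂∈H , unit₂) , w₂ , j₂
  ...     | _    , e₂≢e₁ | inj₁ free₁ | inj₁ free₂ =
    ⊥-elim (matching e₁ e₂ (≢-sym e₂≢e₁) free₁ free₂ v (joins-touch G j₁ , joins-touch G j₂))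

  cost-lower-bound : IsMAP G → ∀ {H} → TwoECSS G ⊥ H → n ≤ 2 * edgeCost G H
  cost-lower-bound is-MAP {H} H-2ecss = begin
    n                         ≡⟨ sym (trans (ℕₚ.+-identityʳ _) (∣⊤∣≡n n)) ⟩
    ∣ ⊤ {n} ∣ + 2 * 0              ≡⟨ cong (λ c → ∣ ⊤ {n} ∣ + 2 * c) (sym (costOf-⊥ (cost G))) ⟩
    ∣ ⊤ {n} ∣ + 2 * edgeCost G ⊥   ≤⟨ unit-edge-cover G ⊤ ⊥⊆ (λ v _ → unit-outside-⊥ (unit-edge-at is-MAP H-2ecss v)) ⟩
    2 * edgeCost G H           ∎
    where
    open ℕₚ.≤-Reasoning
    unit-outside-⊥ : ∀ {v} → Σ (Fin m) (λ e → (e ∈ H × cost G e ≡ 1) × Incident G e v) →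
      Σ (Fin m) λ e → (e ∈ H × e ∉ ⊥ × cost G e ≡ 1) × Incident G e v
    unit-outside-⊥ (e , (e∈H , unit) , inc) = e , (e∈H , ∉⊥ , unit) , inc

  module _ (C : Subset n) where

    inside? : ∀ e → Dec (InsideS G C e)
    inside? e = (src G e ∈? C) ×-dec (tgt G e ∈? C)

    crossing? : ∀ H e → Dec (e ∈ H × ¬ InsideS G C e)
    crossing? H e = (e ∈? H) ×-dec ¬? (inside? e)

    crossing : Subset m → Subset m
    crossing H = select (crossing? H)

    crossing-split : ∀ {H e} → e ∈ H → InsideS G C e ⊎ e ∈ crossing H
    crossing-split {H} {e} e∈H with inside? e
    ... | yes inside = inj₁ inside
    ... | no  crosses = inj₂ (∈-select⁺ (crossing? H) (e∈H , crosses))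

    crossing-2ecss : TwoNodes G C → ∀ {H} → TwoECSS G ⊥ H → TwoECSS G C (crossing H)
    crossing-2ecss two {H} (_ , _ , connected , robust) =
      two , (λ e e∈H' → proj₂ (∈-select⁻ (crossing? H) e∈H')) ,
      (λ u v → reach-contract G (λ e → crossing-split) (connected u v)) ,
      (λ e e∈H' u v → reach-contract G split-without (robust e (proj₁ (∈-select⁻ (crossing? H) e∈H')) u v))
      where
      split-without : ∀ {e} x → x ∈ H - e → InsideS G C x ⊎ x ∈ crossing H - e
      split-without x x∈H-e with ∈-remove⁻ x∈H-e
      ... | x∈H , x≢e with crossing-split x∈H
      ...   | inj₁ inside = inj₁ inside
      ...   | inj₂ x∈H'   = inj₂ (x∈p∧x≢y⇒x∈p-y x∈H' x≢e)

    contraction-saving : IsMAP G → (X : Subset n) → (∀ v w → v ∈ X → Adjacent G v w → w ∈ C) → X ⊆ C →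
      ∀ {H} → TwoECSS G ⊥ H → ∣ X ∣ + 2 * edgeCost G (crossing H) ≤ 2 * edgeCost G H
    contraction-saving is-MAP X closed X⊆C {H} H-2ecss =
      unit-edge-cover G X (λ e∈H' → proj₁ (∈-select⁻ (crossing? H) e∈H')) inner-unit-edge
      where
      inner-unit-edge : ∀ v → v ∈ X → Σ (Fin m) λ e → (e ∈ H × e ∉ crossing H × cost G e ≡ 1) × Incident G e v
      inner-unit-edge v v∈X with unit-edge-at is-MAP H-2ecss v
      ... | e , (e∈H , unit) , w , jvw = e , (e∈H , not-crossing , unit) , w , jvw
        where
        not-crossing : e ∉ crossing H
        not-crossing e∈H' = proj₂ (∈-select⁻ (crossing? H) e∈H') (joins-inside G jvw (X⊆C v∈X) (closed v w v∈X (e , jvw)))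

-- 4-cycles.  Positions of a 4-cycle are read cyclically with 'next'; the arc
-- at j is the cycle without its j-th edge.

arc-positions : Fin 4 → List (Fin 4)
arc-positions j = next j ∷ next (next j) ∷ next (next (next j)) ∷ []

rotation : Fin 4 → List (Fin 4)
rotation j = j ∷ arc-positions j

rotation-distinct : ∀ j → AllPairs _≢_ (rotation j)
rotation-distinct = from-yes (all? (λ j → allPairs? (λ x y → ¬? (x ≟ y)) (rotation j)))

rotation-complete : ∀ j i → i ∈ₗ rotation j
rotation-complete j i = distinct-complete ⊤ (rotation-distinct j) (All.universal (λ _ → ∈⊤) _)
  (ℕₚ.≤-reflexive (∣⊤∣≡n 4)) ∈⊤

next⁴ : ∀ j → next (next (next (next j))) ≡ j
next⁴ zero                   = refl
next⁴ (suc zero)             = refl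
next⁴ (suc (suc zero))       = refl
next⁴ (suc (suc (suc zero))) = refl

rotation-sum : (c : Fin 4 → ℕ) → ∀ j → sum (map c (rotation j)) ≡ c zero + c (suc zero) + c (suc (suc zero)) + c (suc (suc (suc zero)))
rotation-sum c zero                   = from₀ (c zero) (c (suc zero)) (c (suc (suc zero))) (c (suc (suc (suc zero))))
  where from₀ : ∀ x₀ x₁ x₂ x₃ → x₀ + (x₁ + (x₂ + (x₃ + 0))) ≡ x₀ + x₁ + x₂ + x₃
        from₀ = solve-∀
rotation-sum c (suc zero)             = from₁ (c zero) (c (suc zero)) (c (suc (suc zero))) (c (suc (suc (suc zero))))
  where from₁ : ∀ x₀ x₁ x₂ x₃ → x₁ + (x₂ + (x₃ + (x₀ + 0))) ≡ x₀ + x₁ + x₂ + x₃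
        from₁ = solve-∀
rotation-sum c (suc (suc zero))       = from₂ (c zero) (c (suc zero)) (c (suc (suc zero))) (c (suc (suc (suc zero))))
  where from₂ : ∀ x₀ x₁ x₂ x₃ → x₂ + (x₃ + (x₀ + (x₁ + 0))) ≡ x₀ + x₁ + x₂ + x₃
        from₂ = solve-∀
rotation-sum c (suc (suc (suc zero))) = from₃ (c zero) (c (suc zero)) (c (suc (suc zero))) (c (suc (suc (suc zero))))
  where from₃ : ∀ x₀ x₁ x₂ x₃ → x₃ + (x₀ + (x₁ + (x₂ + 0))) ≡ x₀ + x₁ + x₂ + x₃
        from₃ = solve-∀

module _ {n m} {G : Graph n m} (Z : FourCycle G) where

  arc-edges : Fin 4 → List (Fin m)
  arc-edges j = map (edge Z) (arc-positions j)

  arc : ∀ j → Path G (node Z (next j)) (node Z j) (arc-edges j)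
  arc j = joins Z (next j) ∷ joins Z (next (next j)) ∷
          subst (Joins G _ _) (cong (node Z) (next⁴ j)) (joins Z (next (next (next j)))) ∷ []

  around : ∀ j → Path G (node Z j) (node Z j) (map (edge Z) (rotation j))
  around j = joins Z j ∷ arc j

  around-distinct : ∀ j → AllPairs _≢_ (map (edge Z) (rotation j))
  around-distinct j = Unique.map⁺ (λ {x} {y} → edgeInj Z x y) (rotation-distinct j)

  arc-distinct : ∀ j → AllPairs _≢_ (arc-edges j)
  arc-distinct j with around-distinct j
  ... | _ ∷ distinct = distinct

  on-arc : ∀ j i → OnPath G (node Z i) (arc j)
  on-arc j i with rotation-complete j i
  ... | here refl                       = path-end G (arc j)
  ... | there (here refl)               = inj₁ refl
  ... | there (there (here refl))       = inj₂ (inj₁ refl)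
  ... | there (there (there (here refl))) = inj₂ (inj₂ (inj₁ refl))

  arc-nodes : ∀ j {v} → OnPath G v (arc j) → Σ (Fin 4) λ i → node Z i ≡ v
  arc-nodes j (inj₁ refl)                = next j , refl
  arc-nodes j (inj₂ (inj₁ refl))         = next (next j) , refl
  arc-nodes j (inj₂ (inj₂ (inj₁ refl)))  = next (next (next j)) , refl
  arc-nodes j (inj₂ (inj₂ (inj₂ refl)))  = j , refl

  around-nodes : ∀ j {v} → OnPath G v (around j) → Σ (Fin 4) λ i → node Z i ≡ v
  around-nodes j (inj₁ refl) = j , refl
  around-nodes j (inj₂ on)   = arc-nodes j on

  arc-cost : cycleCost Z ≡ 2 → ∀ j → cost G (edge Z j) ≡ 1 → sum (map (cost G) (arc-edges j)) ≡ 1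
  arc-cost cost≡2 j unit = ℕₚ.+-cancelˡ-≡ 1 _ _ (begin
    1 + sum (map (cost G) (arc-edges j))              ≡⟨ cong (_+ sum (map (cost G) (arc-edges j))) (sym unit) ⟩
    sum (map (λ i → cost G (edge Z i)) (rotation j))  ≡⟨ rotation-sum (λ i → cost G (edge Z i)) j ⟩
    cycleCost Z                                       ≡⟨ cost≡2 ⟩
    2                                                 ∎)
    where open ≡-Reasoning

  node-differs : ∀ {i i'} → i ≢ i' → node Z i' ≢ node Z i
  node-differs i≢i' eq = i≢i' (sym (nodeInj Z _ _ eq))

  -- Some unit edge of Z avoids the node k: the two edges of Z opposite to k
  -- meet at a node, so they are not both cost-0 edges of the matching.
  unit-edge-avoiding : IsMAP G → ∀ k → Σ (Fin 4) λ j → cost G (edge Z j) ≡ 1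
    × src G (edge Z j) ≢ node Z k × tgt G (edge Z j) ≢ node Z k
  unit-edge-avoiding (_ , cost≤1 , matching , _) k
    with rotation-distinct k | zero-or-one (cost≤1 (edge Z (next k))) | zero-or-one (cost≤1 (edge Z (next (next k))))
  ... | (k≢k₁ ∷ k≢k₂ ∷ k≢k₃ ∷ []) ∷ _ | inj₂ unit | _ =
    next k , unit , joins-avoid G (joins Z (next k)) (node-differs k≢k₁) (node-differs k≢k₂)
  ... | (k≢k₁ ∷ k≢k₂ ∷ k≢k₃ ∷ []) ∷ _ | inj₁ _ | inj₂ unit =
    next (next k) , unit , joins-avoid G (joins Z (next (next k))) (node-differs k≢k₂) (node-differs k≢k₃)
  ... | _ ∷ (k₁≢k₂ ∷ _) ∷ _ | inj₁ free₁ | inj₁ free₂ =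
    ⊥-elim (matching _ _ (λ eq → k₁≢k₂ (edgeInj Z _ _ eq)) free₁ free₂ (node Z (next (next k)))
      (joins-touch G (joins-sym G (joins Z (next k))) , joins-touch G (joins Z (next (next k)))))

RobustlyConnects : ∀ {n m} → Graph n m → Subset n → Subset m → Set
RobustlyConnects G S F = ∀ x c c' → c ∈ S → c' ∈ S → Reach G ⊥ (F - x) c c'

remove-mono : ∀ {k} {p q : Subset k} {x} → p ⊆ q → p - x ⊆ q - x
remove-mono p⊆q h = let (h∈p , h≢x) = ∈-remove⁻ h in x∈p∧x≢y⇒x∈p-y (p⊆q h∈p) h≢x

-- Uncontracting: a 2-ECSS B of G / C together with edges F that robustly
-- connect C forms a 2-ECSS of G.  (The edge x₀ only witnesses that G has edges.)
uncontract : ∀ {n m} (G : Graph n m) {C F B} → Fin m → TwoNodes G ⊥ → RobustlyConnects G C F →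
  TwoECSS G C B → TwoECSS G ⊥ (F ∪ B)
uncontract G {C} {F} {B} x₀ two robust (_ , _ , connected , B-robust) =
  two , (λ _ _ (s∈⊥ , _) → ∉⊥ s∈⊥) , F∪B-connected , F∪B-robust
  where
  F⊆F∪B : F ⊆ F ∪ B
  F⊆F∪B = p⊆p∪q B
  B⊆F∪B : B ⊆ F ∪ B
  B⊆F∪B = q⊆p∪q F B
  C-connected : ∀ e c c' → c ∈ C → c' ∈ C → Reach G ⊥ ((F ∪ B) - e) c c'
  C-connected e c c' c∈C c'∈C = reach-mono G (remove-mono F⊆F∪B) (robust e c c' c∈C c'∈C)
  F∪B-connected : Connected G ⊥ (F ∪ B)
  F∪B-connected u v = reach-expand G
    (λ c c' c∈C c'∈C → reach-mono G (λ h → proj₁ (∈-remove⁻ h)) (C-connected x₀ c c' c∈C c'∈C)) B⊆F∪B (connected u v)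
  -- removing e ∈ B leaves B - e, which connects G / C; otherwise B survives intact
  F∪B-robust : ∀ e → e ∈ F ∪ B → Connected G ⊥ ((F ∪ B) - e)
  F∪B-robust e _ u v with e ∈? B
  ... | yes e∈B = reach-expand G (C-connected e) (remove-mono B⊆F∪B) (B-robust e e∈B u v)
  ... | no  e∉B = reach-expand G (C-connected e) (λ f∈B → x∈p∧x≢y⇒x∈p-y (B⊆F∪B f∈B) λ { refl → e∉B f∈B }) (connected u v)

cycles-cover : ∀ {n m} {G : Graph n m} {C : Subset n} (Z₁ Z₂ : FourCycle G) →
  (∀ i → node Z₁ i ∈ C) → (∀ i → node Z₂ i ∈ C) → (∀ i i' → node Z₁ i ≢ node Z₂ i') → ∣ C ∣ ≡ 8 →
  ∀ {c} → c ∈ C → OnCycle c Z₁ ⊎ OnCycle c Z₂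
cycles-cover {n} {G = G} {C} Z₁ Z₂ in₁ in₂ disjoint size c∈C =
  Data.Sum.map (on-nodes Z₁) (on-nodes Z₂) (∈-++⁻ (nodes Z₁) (distinct-complete C distinct all-in (ℕₚ.≤-reflexive size) c∈C))
  where
  nodes : FourCycle G → List (Fin n)
  nodes Z = map (node Z) (allFin 4)
  on-nodes : ∀ Z {v} → v ∈ₗ nodes Z → OnCycle v Z
  on-nodes Z v∈Z = let (i , _ , v≡) = ∈-map⁻ (node Z) v∈Z in i , sym v≡
  in-C : ∀ Z → (∀ i → node Z i ∈ C) → All (_∈ C) (nodes Z)
  in-C Z in-Z = All.tabulate λ v∈Z → let (i , node≡v) = on-nodes Z v∈Z in subst (_∈ C) node≡v (in-Z i)
  distinct : AllPairs _≢_ (nodes Z₁ ++ nodes Z₂)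
  distinct = Unique.++⁺ (Unique.map⁺ (nodeInj Z₁ _ _) (Unique.allFin⁺ 4)) (Unique.map⁺ (nodeInj Z₂ _ _) (Unique.allFin⁺ 4))
    λ (v∈Z₁ , v∈Z₂) → let (i , ≡v) = on-nodes Z₁ v∈Z₁ ; (i' , ≡v') = on-nodes Z₂ v∈Z₂ in disjoint i i' (trans ≡v (sym ≡v'))
  all-in : All (_∈ C) (nodes Z₁ ++ nodes Z₂)
  all-in = ++⁺ (in-C Z₁ in₁) (in-C Z₂ in₂)

-- F consists of C₁, g, C₂ without its j-th edge,
-- and h: a cycle with an ear through all of C₂.
module R8-Completion {n m} (G : Graph n m) (C : Subset n) (C₁ C₂ : FourCycle G)
  (in₁ : ∀ i → node C₁ i ∈ C) (in₂ : ∀ i → node C₂ i ∈ C) (disjoint : ∀ i i' → node C₁ i ≢ node C₂ i')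
  (j : Fin 4) {w w' : Fin n} {g h : Fin m}
  (jg : Joins G g (node C₂ (next j)) w) (jh : Joins G h (node C₂ j) w')
  (w-on : OnCycle w C₁) (w'-on : OnCycle w' C₁) where

  cycle-edges ear-edges : List (Fin m)
  cycle-edges = map (edge C₁) (rotation zero)
  ear-edges   = g ∷ arc-edges C₂ j ++ h ∷ []

  F : Subset m
  F = setOf (cycle-edges ++ ear-edges)

  cycle⊆F : All (_∈ F) cycle-edges
  cycle⊆F = All.tabulate λ e∈ → ∈-setOf⁺ {es = cycle-edges ++ ear-edges} (∈-++⁺ˡ e∈)

  ear⊆F : All (_∈ F) ear-edges
  ear⊆F = All.tabulate λ e∈ → ∈-setOf⁺ (∈-++⁺ʳ cycle-edges e∈)

  arc⊆F : All (_∈ F) (arc-edges C₂ j)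
  arc⊆F = All.tabulate λ e∈ → All.lookup ear⊆F (there (∈-++⁺ˡ e∈))

  g∈F : g ∈ F
  g∈F = All.lookup ear⊆F (here refl)

  h∈F : h ∈ F
  h∈F = All.lookup ear⊆F (there (∈-++⁺ʳ (arc-edges C₂ j) (here refl)))

  on-C₁-in : ∀ {v} → OnCycle v C₁ → v ∈ C
  on-C₁-in (i , refl) = in₁ i

  F-inside : InE G C F
  F-inside e e∈F = All.lookup all-inside (∈-setOf⁻ _ e∈F)
    where
    all-inside : All (InsideS G C) (cycle-edges ++ ear-edges)
    all-inside = ++⁺ (path-inside G (around C₁ zero) λ on → on-C₁-in (around-nodes C₁ zero on))
      (joins-inside G jg (in₂ _) (on-C₁-in w-on) ∷
       ++⁺ (path-inside G (arc C₂ j) λ on → let (i , node≡v) = arc-nodes C₂ j on in subst (_∈ C) node≡v (in₂ i))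
           (joins-inside G jh (in₂ _) (on-C₁-in w'-on) ∷ []))

  F-cost : cycleCost C₁ ≡ 2 → cycleCost C₂ ≡ 2 → (∀ e → cost G e ≤ 1) → cost G (edge C₂ j) ≡ 1 → edgeCost G F ≤ 5
  F-cost C₁-cost C₂-cost cost≤1 unit = begin
    edgeCost G F                                                     ≤⟨ costOf-setOf c (cycle-edges ++ ear-edges) ⟩
    sum (map c (cycle-edges ++ ear-edges))                           ≡⟨ sum-map-++ cycle-edges ear-edges ⟩
    sum (map c cycle-edges) + (c g + sum (map c (arc-edges C₂ j ++ h ∷ [])))
                                                                     ≡⟨ cong₂ (λ s t → s + (c g + t)) cycle-sum (sum-map-++ (arc-edges C₂ j) (h ∷ [])) ⟩
    2 + (c g + (sum (map c (arc-edges C₂ j)) + (c h + 0)))           ≡⟨ cong (λ t → 2 + (c g + (t + (c h + 0)))) (arc-cost C₂ C₂-cost j unit) ⟩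
    2 + (c g + (1 + (c h + 0)))                                      ≤⟨ ℕₚ.+-monoʳ-≤ 2 (ℕₚ.+-mono-≤ (cost≤1 g) (ℕₚ.+-monoʳ-≤ 1 (ℕₚ.+-monoˡ-≤ 0 (cost≤1 h)))) ⟩
    5                                                                ∎
    where
    open ℕₚ.≤-Reasoning
    c = cost G
    sum-map-++ : ∀ xs ys → sum (map c (xs ++ ys)) ≡ sum (map c xs) + sum (map c ys)
    sum-map-++ xs ys = trans (cong sum (map-++ c xs ys)) (sum-++ (map c xs) (map c ys))
    cycle-sum : sum (map c cycle-edges) ≡ 2
    cycle-sum = trans (rotation-sum (λ i → c (edge C₁ i)) zero) C₁-cost

  -- After removing any edge x, every node of C still reaches node 0 of C₁:
  -- around C₁ for the nodes of C₁, along the ear and then around C₁ for those of C₂.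
  hub : Fin n
  hub = node C₁ zero

  C₁-to-hub : ∀ x {v} → OnCycle v C₁ → Reach G ⊥ (F - x) v hub
  C₁-to-hub x (i , refl) =
    [ id , id ]′ (path-split G (around C₁ zero) (around-distinct C₁ zero) cycle⊆F x (inj₂ (on-arc C₁ zero i)))

  -- nodes of C₁ are not on the arc of C₂, so g and h are not arc edges
  off-arc : ∀ {v} → OnCycle v C₁ → ¬ OnPath G v (arc C₂ j)
  off-arc (i , refl) on = let (i' , node≡) = arc-nodes C₂ j on in disjoint i i' (sym node≡)

  -- g ends at node (next j) of C₂, which is no end of h
  g≢h : g ≢ h
  g≢h with rotation-distinct j
  ... | (j≢j₁ ∷ _) ∷ _ = edges-differ G jg jh (node-differs C₂ j≢j₁) (off-C₁ w'-on)
    where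
    off-C₁ : ∀ {v} → OnCycle v C₁ → node C₂ (next j) ≢ v
    off-C₁ (i , refl) eq = disjoint i (next j) (sym eq)

  C₂-to-hub : ∀ x i → Reach G ⊥ (F - x) (node C₂ i) hub
  C₂-to-hub x i with ear-split G (arc C₂ j) (arc-distinct C₂ j) arc⊆F jg jh g∈F h∈F g≢h
                       (edge-off-path G (arc C₂ j) jg (off-arc w-on)) (edge-off-path G (arc C₂ j) jh (off-arc w'-on))
                       x (on-arc C₂ j i)
  ... | inj₁ to-w  = reach-trans G to-w  (C₁-to-hub x w-on)
  ... | inj₂ to-w' = reach-trans G to-w' (C₁-to-hub x w'-on)

  F-robust : ∣ C ∣ ≡ 8 → RobustlyConnects G C F
  F-robust size x c c' c∈C c'∈C = reach-trans G (to-hub c∈C) (reach-sym G (to-hub c'∈C))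
    where
    to-hub : ∀ {v} → v ∈ C → Reach G ⊥ (F - x) v hub
    to-hub v∈C with cycles-cover C₁ C₂ in₁ in₂ disjoint size v∈C
    ... | inj₁ on₁        = C₁-to-hub x on₁
    ... | inj₂ (i , refl) = C₂-to-hub x i

-- The unit edge of C₂ avoiding the attachment
-- a₂ has both ends adjacent to C₁, which provides the ear of R8-Completion.
r8-completion : ∀ {n m} (G : Graph n m) → IsMAP G → ∀ C → IsR8 G C →
  Σ (Subset m) λ F → InE G C F × edgeCost G F ≤ 5 × RobustlyConnects G C F
r8-completion G is-MAP@(_ , cost≤1 , _) C
  (size , _ , C₁ , C₂ , _ , _ , in₁ , in₂ , disjoint , cost₁ , cost₂ , _ , (k , refl) , _ , _ , _ , _ , unit-edges₂)
  with unit-edge-avoiding C₂ is-MAP k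
... | j , unit , src≢a₂ , tgt≢a₂ with unit-edges₂ j unit src≢a₂ tgt≢a₂
...   | src-adjacent , tgt-adjacent
  with ends-of G {P = λ v → Σ (Fin _) λ w → OnCycle w C₁ × Adjacent G v w} (joins C₂ j) src-adjacent tgt-adjacent
...     | (w' , w'-on , h , jh) , (w , w-on , g , jg) =
  F , F-inside , F-cost cost₁ cost₂ cost≤1 unit , F-robust size
  where open R8-Completion G C C₁ C₂ in₁ in₂ disjoint j jg jh w-on w'-on

-- G / S has two nodes if S is a proper subset containing some node c:
-- c and any node outside S.
proper-two-nodes : ∀ {n m} (G : Graph n m) {S : Subset n} {c} → S ≢ ⊤ → c ∈ S → TwoNodes G S
proper-two-nodes {n} G {S} {c} S≢⊤ c∈S with ¬∀⟶∃¬ n (_∈ S) (_∈? S) (λ all-in → S≢⊤ (⊆-antisym (λ _ → ∈⊤) (λ {u} _ → all-in u)))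
... | u , u∉S = u , c , (λ { refl → u∉S c∈S }) , λ (u∈S , _) → u∉S u∈S

cycle-two-nodes : ∀ {n m} {G : Graph n m} → FourCycle G → TwoNodes G ⊥
cycle-two-nodes Z = node Z zero , node Z (suc zero) , (λ eq → 0≢1 (nodeInj Z zero (suc zero) eq)) , λ (u∈⊥ , _) → ∉⊥ u∈⊥
  where
  0≢1 : zero ≢ suc zero
  0≢1 ()

-- (imported only here: the prefix +_ would make sections such as (c +_) above ambiguous)
open import Data.Integer using (+_)

-- opt(G / S) exists, in the double-negated sense appropriate constructively:
-- if no cost were optimal, every 2-ECSS would cost at least k for every k.
optimum-exists : ∀ {n m} (G : Graph n m) S B → TwoECSS G S B → ¬ ¬ (Σ ℕ λ o → IsOpt G S o)
optimum-exists G S B B-2ecss no-opt = ℕₚ.<-irrefl refl (above (suc (edgeCost G B)) B B-2ecss)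
  where
  above : ∀ k F → TwoECSS G S F → k ≤ edgeCost G F
  above zero    F _ = z≤n
  above (suc k) F F-2ecss with k ℕ.≟ edgeCost G F
  ... | yes k≡ = ⊥-elim (no-opt (k , (F , F-2ecss , sym k≡) , above k))
  ... | no  k≢ = ℕₚ.≤∧≢⇒< (above k F F-2ecss) k≢

module _ {n m} (G : Graph n m) (is-MAP : IsMAP G) where

  -- Every node needs a unit edge, so opt(G) ≥ n / 2.
  opt-lower-bound : ∀ {o} → IsOpt G ⊥ o → n ≤ 2 * o
  opt-lower-bound ((H , H-2ecss , refl) , _) = cost-lower-bound G is-MAP H-2ecss

  -- For an 8-node set C with two attachments, opt(G / C) + 3 ≤ opt(G): the six
  -- other nodes of C need three unit edges inside C, which G / C does not pay for.
  opt-gap : ∀ {C a₁ a₂ o' o} → TwoNodes G C → ∣ C ∣ ≡ 8 → (∀ a → Attachment G C a → a ≡ a₁ ⊎ a ≡ a₂) →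
    IsOpt G C o' → IsOpt G ⊥ o → o' + 3 ≤ o
  opt-gap {C} {a₁} {a₂} {o'} two size attachments (_ , minimal) ((H , H-2ecss , refl) , _) =
    ℕₚ.*-cancelˡ-≤ 2 (begin
      2 * (o' + 3)                                   ≡⟨ trans (ℕₚ.*-distribˡ-+ 2 o' 3) (ℕₚ.+-comm (2 * o') 6) ⟩
      6 + 2 * o'                                     ≤⟨ ℕₚ.+-mono-≤ six-inner (ℕₚ.*-monoʳ-≤ 2 (minimal _ (crossing-2ecss G C two H-2ecss))) ⟩
      ∣ inner ∣ + 2 * edgeCost G (crossing G C H)    ≤⟨ contraction-saving G C is-MAP inner closed p-x-y⊆p H-2ecss ⟩
      2 * edgeCost G H                               ∎)
    where
    open ℕₚ.≤-Reasoning
    inner : Subset n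
    inner = C - a₁ - a₂
    six-inner : 6 ≤ ∣ inner ∣
    six-inner = ℕₚ.+-cancelʳ-≤ 2 6 ∣ inner ∣ (subst (_≤ ∣ inner ∣ + 2) size (∣p∣≤∣p-x-y∣+2 C a₁ a₂))
    closed : ∀ v w → v ∈ inner → Adjacent G v w → w ∈ C
    closed v w v∈inner adj with w ∈? C | ∈-remove⁻ v∈inner
    ... | yes w∈C | _ = w∈C
    ... | no  w∉C | v∈C-a₁ , v≢a₂ with attachments v (proj₁ (∈-remove⁻ v∈C-a₁) , w , w∉C , adj)
    ...   | inj₁ v≡a₁ = ⊥-elim (proj₂ (∈-remove⁻ v∈C-a₁) v≡a₁)
    ...   | inj₂ v≡a₂ = ⊥-elim (v≢a₂ v≡a₂)

  -- The approximation guarantee for B in G / C carries over to any edge set of G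
  -- costing at most 5 more, once opt(G) ≥ 6 (here from n ≥ 12).
  ratio-transfer : ∀ {C a₁ a₂ B K} (α : ℚ) → (+ 5 / 3) Q.≤ α → 12 ≤ n → TwoNodes G C → ∣ C ∣ ≡ 8 →
    (∀ a → Attachment G C a → a ≡ a₁ ⊎ a ≡ a₂) → TwoECSS G C B →
    (∀ o' → IsOpt G C o' → WithinBound α (edgeCost G B) o') → edgeCost G K ≤ edgeCost G B + 5 →
    ∀ o → IsOpt G ⊥ o → WithinBound α (edgeCost G K) o
  ratio-transfer {C} {B = B} α α≥5/3 n≥12 two size attachments B-2ecss B-bound K-cost o opt =
    decidable-stable (_ ℚₚ.≤? _) λ unbounded → optimum-exists G C B B-2ecss λ (o' , opt') →
      unbounded (bound-step α _ _ o' o α≥5/3 K-cost (opt-gap two size attachments opt' opt) six≤o (B-bound o' opt'))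
    where
    six≤o : 6 ≤ o
    six≤o = ℕₚ.*-cancelˡ-≤ 2 (ℕₚ.≤-trans n≥12 (opt-lower-bound opt))

lemma20 : ∀ {n m} (G : Graph n m) (α : ℚ) → ((+ 5) / 3) Q.≤ α →
    IsMAP G → TwoNodeConnected G → 12 ≤ n →
    (C : Subset n) → IsR8 G C →
    (B : Subset m) → TwoECSS G C B →
    (∀ o → IsOpt G C o → WithinBound α (edgeCost G B) o) →
    Σ (Subset m) λ F → InE G C F × edgeCost G F ≤ 5
    × TwoECSS G ⊥ (F ∪ B)
    × (∀ o → IsOpt G ⊥ o → WithinBound α (edgeCost G (F ∪ B)) o)
lemma20 G α α≥5/3 is-MAP _ n≥12 C r8@(size , C≢V , C₁ , _ , _ , _ , in₁ , _ , _ , _ , _ , _ , _ , _ , _ , attachments , _)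
  B B-2ecss B-bound with r8-completion G is-MAP C r8
... | F , F-inside , F-cost , F-robust =
  F , F-inside , F-cost , uncontract G (edge C₁ zero) (cycle-two-nodes C₁) F-robust B-2ecss ,
  ratio-transfer G is-MAP α α≥5/3 n≥12 (proper-two-nodes G C≢V (in₁ zero)) size attachments B-2ecss B-bound F∪B-cost
  where
  F∪B-cost : edgeCost G (F ∪ B) ≤ edgeCost G B + 5
  F∪B-cost = ℕₚ.≤-trans (costOf-∪ (cost G) F B) (ℕₚ.≤-trans (ℕₚ.+-monoˡ-≤ _ F-cost) (ℕₚ.≤-reflexive (ℕₚ.+-comm 5 _)))
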